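{- Let $G$ be a finite graph in which no induced cycle has length divisible by three, and let $g$ be a good counter on $G$ with $g(\emptyset)\ge 2$. Then $g(\emptyset)=2$; $g(\{v\})=1$ for every vertex $v\in V(G)$; and $G$ is connected.
   Context: All graphs are finite with no loops or parallel edges. For disjoint $X,Y\subseteq V(G)$, $f_G(X,Y)$ is the sum of $(-1)^{|A|}$ over all stable sets $A$ of $G$ with $X\subseteq A$ and $A\cap Y=\emptyset$. A counter on $G$ is either of the functions $f_G$ or $-f_G$. For a counter $g$ and $X\subseteq V(G)$ write $g(X)=g(X,\emptyset)$. A counter $g$ is good if for all disjoint $X,Y\subseteq V(G)$ with $X\cup Y\neq\emptyset$: (i) $|g(X,Y)|\le 1$; and (ii) $|g(X\cup\{u\},Y)-g(X\cup\{v\},Y)|\le 1$ for all $u,v\in V(G)\setminus(X\cup Y)$. -}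

module Defs where

open import Data.Nat using (ℕ; zero; suc; _≤_; _%_)
open import Data.Nat.Divisibility using (_∣_)
open import Data.Bool using (Bool; true; false; _∧_; _∨_; not; if_then_else_)
open import Data.Fin using (Fin; toℕ)
open import Data.Fin.Subset using (Subset) renaming (∣_∣ to card)
open import Data.Vec using (Vec; []; _∷_; lookup)
open import Data.List using (List; []; _∷_; map; concatMap; foldr; allFin)
open import Data.Integer using (ℤ; +_; -_; 0ℤ; 1ℤ)
open import Data.Product using (_×_)
open import Data.Sum using (_⊎_)
open import Data.Integer using (∣_∣; _-_; _+_)
open import Data.Fin.Subset using (_∈_; _∉_; _∪_; _∩_; ⁅_⁆; ⊥; Nonempty; Empty)
open import Function.Definitions using (Injective)
open import Relation.Binary.PropositionalEquality using (_≡_)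
open import Relation.Nullary using (¬_)

record Graph (n : ℕ) : Set where
  field
    adj   : Fin n → Fin n → Bool
    sym   : ∀ u v → adj u v ≡ adj v u
    irrefl : ∀ v → adj v v ≡ false
open Graph public

_~[_]_ : ∀ {n} → Fin n → Graph n → Fin n → Set
u ~[ G ] v = adj G u v ≡ true

allL : ∀ {A : Set} → (A → Bool) → List A → Bool
allL p = foldr (λ x b → p x ∧ b) true

allSubsets : (n : ℕ) → List (Subset n)
allSubsets zero = [] ∷ []
allSubsets (suc n) = concatMap (λ s → (false ∷ s) ∷ (true ∷ s) ∷ []) (allSubsets n)

isStable : ∀ {n} → Graph n → Subset n → Bool
isStable {n} G A =
  allL (λ u → allL (λ v → not (lookup A u ∧ lookup A v ∧ adj G u v)) (allFin n)) (allFin n)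

subsetB : ∀ {n} → Subset n → Subset n → Bool
subsetB {n} X A = allL (λ v → not (lookup X v) ∨ lookup A v) (allFin n)

disjointB : ∀ {n} → Subset n → Subset n → Bool
disjointB {n} A Y = allL (λ v → not (lookup A v ∧ lookup Y v)) (allFin n)

signPow : ℕ → ℤ
signPow zero = 1ℤ
signPow (suc k) = - signPow k

f : ∀ {n} → Graph n → Subset n → Subset n → ℤ
f {n} G X Y =
  foldr _+_ 0ℤ (map (λ A → if isStable G A ∧ subsetB X A ∧ disjointB A Y then signPow (card A) else 0ℤ)
           (allSubsets n))

counter : ∀ {n} → Graph n → Bool → Subset n → Subset n → ℤ
counter G true  X Y = f G X Y
counter G false X Y = - f G X Y

cycAdj : ∀ {k} → Fin k → Fin k → Set
cycAdj {k} i j =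
  (toℕ j ≡ suc (toℕ i)) ⊎ (toℕ i ≡ suc (toℕ j))
  ⊎ ((toℕ i ≡ 0 × suc (toℕ j) ≡ k) ⊎ (toℕ j ≡ 0 × suc (toℕ i) ≡ k))

IsInducedCycle : ∀ {n} → Graph n → (k : ℕ) → (Fin k → Fin n) → Set
IsInducedCycle G k c =
  3 ≤ k × Injective _≡_ _≡_ c
  × (∀ i j → (c i ~[ G ] c j → cycAdj i j) × (cycAdj i j → c i ~[ G ] c j))

NoInducedCycleLen0mod3 : ∀ {n} → Graph n → Set
NoInducedCycleLen0mod3 G = ∀ k (c : Fin _ → Fin _) → IsInducedCycle G k c → ¬ (3 ∣ k)

IsGood : ∀ {n} → Graph n → Bool → Set
IsGood {n} G s =
  ∀ (X Y : Subset n) → Empty (X ∩ Y) → Nonempty (X ∪ Y) →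
    (∣ counter G s X Y ∣ ≤ 1)
    × (∀ u v → u ∉ (X ∪ Y) → v ∉ (X ∪ Y) →
         ∣ counter G s (X ∪ ⁅ u ⁆) Y - counter G s (X ∪ ⁅ v ⁆) Y ∣ ≤ 1)

data Reachable {n} (G : Graph n) : Fin n → Fin n → Set where
  here : ∀ {v} → Reachable G v v
  step : ∀ {u v w} → u ~[ G ] v → Reachable G v w → Reachable G u w

Connected : ∀ {n} → Graph n → Set
Connected {n} G = ∀ (u v : Fin n) → Reachable G u v

module Submission where

open import Defs
open import Data.Bool using (Bool)
open import Data.Fin using (Fin)
open import Data.Fin.Subset using (⊥; ⁅_⁆)
open import Data.Integer using (ℤ; +_; _≤_)
open import Data.Nat using (ℕ)
open import Data.Product using (_×_)
open import Relation.Binary.PropositionalEquality using (_≡_)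

-- The conclusions follow from goodness alone.
--
-- Write g = ±f_G. For every vertex t the deletion–contraction identity
--   f(X,Y) = f(X, Y ∪ {t}) + f(X ∪ {t}, Y)
-- holds. Applied at X = Y = ∅ it writes g(∅) as a sum of two values of modulus
-- at most 1, so g(∅) ≥ 2 forces both to be 1 and g(∅) = 2.
-- For connectedness let C be a set closed under adjacency. Expanding f(X,Y)
-- with the same identity until every vertex is decided, and using that a set
-- meeting both C and its complement is stable iff both halves are, gives the
-- product formula f(∅,∅) = f(∅, V∖C) · f(∅, C). If the component C of some
-- vertex missed another vertex, both factors would be values of g at nonempty
-- forbidden sets, hence of modulus at most 1, contradicting |g(∅)| ≥ 2.

open import Data.Bool using (true; false; _∧_; _∨_; not; if_then_else_)
open import Data.Bool.Properties using (⇔→≡; ¬-not; not-¬; ∧-zeroʳ; ∧-identityʳ)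
import Data.Bool.Properties as Bool
open import Data.Empty using (⊥-elim)
open import Data.Fin using (zero)
open import Data.Fin.Properties using (any?)
open import Data.Fin.Subset using (Subset; _∈_; _∉_; _⊆_; _∪_; _∩_; ∁; Nonempty; Empty; ⊤)
  renaming (∣_∣ to card)
open import Data.Fin.Subset.Properties
  using ( _∈?_; x∈p∪q⁻; p⊆p∪q; q⊆p∪q; x∈⁅x⁆; x∈⁅y⁆⇒x≡y; ∉⊥; ∣p∣≤n; ∣⁅x⁆∣≡1
        ; x∈p⇒x∉∁p; x∈∁p⇒x∉p; x∉p⇒x∈∁p; x∉∁p⇒x∈p; x∈p∩q⁺; x∈p∩q⁻; p∩q⊆q; p∪∁p≡⊤; ⊆-refl; ⊆-antisym
        ; Empty-unique; ∪-assoc; ∪-comm; ∪-identityˡ; ∪-identityʳ; ∩-zeroˡ; ∩-zeroʳ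
        ; ∩-identityʳ; ∩-distribˡ-∪; ∩-distribʳ-∪; ∪-∩-booleanAlgebra )
open import Data.Vec using ([]; _∷_; lookup)
import Data.Vec.Base as Vec
open import Data.Vec.Properties using ([]=⇒lookup; lookup⇒[]=; ∷-injectiveʳ)
open import Data.List using (List; []; _∷_; map; foldr; allFin; concatMap)
import Data.List.Relation.Unary.Any as Any
open import Data.List.Membership.Propositional using () renaming (_∈_ to _∈ₗ_)
open import Data.List.Membership.Propositional.Properties using (∈-allFin)
open import Data.Integer using (0ℤ; -_; -[1+_]; ∣_∣; _+_; _*_; +≤+; -≤+)
open import Data.Integer.Properties
  using ( +-identityˡ; +-identityʳ; +-assoc; *-zeroʳ; *-identityˡ; *-comm; *-distribʳ-+
        ; neg-distrib-+; neg-distribˡ-*; ∣-i∣≡∣i∣; abs-*; ≤-trans; +-monoʳ-≤; +-monoˡ-≤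
        ; +-comm; +-commutativeSemigroup )
open import Algebra.Properties.CommutativeSemigroup +-commutativeSemigroup using (interchange)
import Algebra.Lattice.Properties.BooleanAlgebra as BooleanAlgebraProperties
import Data.Nat as Nat
import Data.Nat.Properties as Nat
open import Data.Product using (_,_; proj₁; proj₂)
open import Data.Sum using (_⊎_; inj₁; inj₂; [_,_])
import Data.Sum as Sum
open import Function using (_∘_)
open import Function.Bundles using (mk⇔)
open import Relation.Nullary using (¬_; Dec; yes; no; ¬?)
open import Relation.Nullary.Decidable using (_×-dec_)
open import Relation.Binary.PropositionalEquality
  using (refl; trans; cong; cong₂; subst; subst₂; _≢_; module ≡-Reasoning)
  renaming (sym to ≡-sym)

private
  variable
    n : ℕ
    t u v : Fin n
    A C D P Q X Y : Subset n

∧-true : ∀ {a b} → a ∧ b ≡ true → a ≡ true × b ≡ true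
∧-true {true} e = refl , e

true-∧ : ∀ {a b} → a ≡ true → b ≡ true → a ∧ b ≡ true
true-∧ refl e = e

not-true : ∀ {a} → not a ≡ true → a ≡ false
not-true {false} refl = refl

allL-sound : ∀ {S : Set} (p : S → Bool) {xs : List S} →
  allL p xs ≡ true → ∀ {x} → x ∈ₗ xs → p x ≡ true
allL-sound p {_ ∷ _} e (Any.here refl) = proj₁ (∧-true e)
allL-sound p {_ ∷ _} e (Any.there x∈xs) = allL-sound p (proj₂ (∧-true e)) x∈xs

allL-complete : ∀ {S : Set} (p : S → Bool) (xs : List S) →
  (∀ x → p x ≡ true) → allL p xs ≡ true
allL-complete p [] h = refl
allL-complete p (x ∷ xs) h = true-∧ (h x) (allL-complete p xs h)

everyVertex : (p : Fin n → Bool) → allL p (allFin n) ≡ true → ∀ v → p v ≡ true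
everyVertex p e v = allL-sound p e (∈-allFin v)

∈⇒true : v ∈ A → lookup A v ≡ true
∈⇒true = []=⇒lookup

true⇒∈ : lookup A v ≡ true → v ∈ A
true⇒∈ {A = A} {v} = lookup⇒[]= v A

∉⇒false : v ∉ A → lookup A v ≡ false
∉⇒false v∉A = ¬-not (v∉A ∘ true⇒∈)

false⇒∉ : lookup A v ≡ false → v ∉ A
false⇒∉ e = not-¬ e ∘ ∈⇒true

Stable : Graph n → Subset n → Set
Stable G A = ∀ {u v} → u ∈ A → v ∈ A → adj G u v ≡ false

Disjoint : Subset n → Subset n → Set
Disjoint A Y = ∀ {v} → v ∈ A → v ∉ Y

isStable-sound : (G : Graph n) (A : Subset n) → isStable G A ≡ true → Stable G A
isStable-sound G A e {u} {v} u∈A v∈A =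
  not-true (subst₂ (λ a b → not (a ∧ b ∧ adj G u v) ≡ true) (∈⇒true u∈A) (∈⇒true v∈A)
                   (everyVertex _ (everyVertex _ e u) v))

isStable-complete : (G : Graph n) (A : Subset n) → Stable G A → isStable G A ≡ true
isStable-complete {n} G A stable =
  allL-complete _ (allFin n) (λ u → allL-complete _ (allFin n) (nonEdge u))
  where
  nonEdge : ∀ u v → not (lookup A u ∧ lookup A v ∧ adj G u v) ≡ true
  nonEdge u v with lookup A u in eu | lookup A v in ev
  ... | false | _     = refl
  ... | true  | false = refl
  ... | true  | true  rewrite stable (true⇒∈ eu) (true⇒∈ ev) = refl

subsetB-sound : (X A : Subset n) → subsetB X A ≡ true → X ⊆ A
subsetB-sound X A e {v} v∈X =
  true⇒∈ (subst (λ x → not x ∨ lookup A v ≡ true) (∈⇒true v∈X) (everyVertex _ e v))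

subsetB-complete : (X A : Subset n) → X ⊆ A → subsetB X A ≡ true
subsetB-complete {n} X A X⊆A = allL-complete _ (allFin n) inclusion
  where
  inclusion : ∀ v → not (lookup X v) ∨ lookup A v ≡ true
  inclusion v with lookup X v in e
  ... | false = refl
  ... | true  = ∈⇒true (X⊆A (true⇒∈ e))

disjointB-sound : (A Y : Subset n) → disjointB A Y ≡ true → Disjoint A Y
disjointB-sound A Y e {v} v∈A =
  false⇒∉ (not-true (subst (λ a → not (a ∧ lookup Y v) ≡ true) (∈⇒true v∈A) (everyVertex _ e v)))

disjointB-complete : (A Y : Subset n) → Disjoint A Y → disjointB A Y ≡ true
disjointB-complete {n} A Y disjoint = allL-complete _ (allFin n) separate
  where
  separate : ∀ v → not (lookup A v ∧ lookup Y v) ≡ true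
  separate v with lookup A v in e
  ... | false = refl
  ... | true rewrite ∉⇒false (disjoint (true⇒∈ e)) = refl

-- Deletion–contraction

∈-∪⁅⁆ : ∀ {X : Subset n} {t v} → v ∈ X ∪ ⁅ t ⁆ → v ∈ X ⊎ v ≡ t
∈-∪⁅⁆ {X = X} {t} m = Sum.map₂ (x∈⁅y⁆⇒x≡y t) (x∈p∪q⁻ X ⁅ t ⁆ m)

∈-∪⁅⁆-old : ∀ {X : Subset n} {t v} → v ∈ X → v ∈ X ∪ ⁅ t ⁆
∈-∪⁅⁆-old {t = t} = p⊆p∪q ⁅ t ⁆

∈-∪⁅⁆-new : ∀ {X : Subset n} {t} → t ∈ X ∪ ⁅ t ⁆
∈-∪⁅⁆-new {X = X} {t} = q⊆p∪q X ⁅ t ⁆ (x∈⁅x⁆ t)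

subsetB-∪-in : (X A : Subset n) → t ∈ A → subsetB (X ∪ ⁅ t ⁆) A ≡ subsetB X A
subsetB-∪-in {t = t} X A t∈A = ⇔→≡ (mk⇔
  (λ e → subsetB-complete X A (subsetB-sound (X ∪ ⁅ t ⁆) A e ∘ ∈-∪⁅⁆-old))
  (λ e → subsetB-complete (X ∪ ⁅ t ⁆) A ([ subsetB-sound X A e , (λ { refl → t∈A }) ] ∘ ∈-∪⁅⁆)))

subsetB-∪-out : (X A : Subset n) → t ∉ A → subsetB (X ∪ ⁅ t ⁆) A ≡ false
subsetB-∪-out {t = t} X A t∉A = ¬-not (λ e → t∉A (subsetB-sound (X ∪ ⁅ t ⁆) A e ∈-∪⁅⁆-new))

disjointB-∪-in : (A Y : Subset n) → t ∈ A → disjointB A (Y ∪ ⁅ t ⁆) ≡ false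
disjointB-∪-in {t = t} A Y t∈A = ¬-not (λ e → disjointB-sound A (Y ∪ ⁅ t ⁆) e t∈A ∈-∪⁅⁆-new)

disjointB-∪-out : (A Y : Subset n) → t ∉ A → disjointB A (Y ∪ ⁅ t ⁆) ≡ disjointB A Y
disjointB-∪-out {t = t} A Y t∉A = ⇔→≡ (mk⇔
  (λ e → disjointB-complete A Y (λ v∈A → disjointB-sound A (Y ∪ ⁅ t ⁆) e v∈A ∘ ∈-∪⁅⁆-old))
  (λ e → disjointB-complete A (Y ∪ ⁅ t ⁆) (λ v∈A →
     [ disjointB-sound A Y e v∈A , (λ { refl → t∉A v∈A }) ] ∘ ∈-∪⁅⁆)))

term : Graph n → Subset n → Subset n → Subset n → ℤ
term G X Y A = if isStable G A ∧ subsetB X A ∧ disjointB A Y then signPow (card A) else 0ℤ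

sumL : (Subset n → ℤ) → List (Subset n) → ℤ
sumL h L = foldr _+_ 0ℤ (map h L)

sumL-cong : (h k : Subset n → ℤ) (L : List (Subset n)) →
  (∀ A → h A ≡ k A) → sumL h L ≡ sumL k L
sumL-cong h k [] eq = refl
sumL-cong h k (A ∷ L) eq = cong₂ _+_ (eq A) (sumL-cong h k L eq)

sumL-+ : (h k : Subset n → ℤ) (L : List (Subset n)) →
  sumL (λ A → h A + k A) L ≡ sumL h L + sumL k L
sumL-+ h k [] = refl
sumL-+ h k (A ∷ L) = trans (cong (_+_ (h A + k A)) (sumL-+ h k L))
                           (interchange (h A) (k A) (sumL h L) (sumL k L))

-- Each summand A either contains t (and contributes to requiring t) or not
-- (and contributes to forbidding t).
term-split : (G : Graph n) (X Y A : Subset n) (t : Fin n) →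
  term G X Y A ≡ term G X (Y ∪ ⁅ t ⁆) A + term G (X ∪ ⁅ t ⁆) Y A
term-split G X Y A t with t ∈? A
... | yes t∈A rewrite disjointB-∪-in A Y t∈A | subsetB-∪-in X A t∈A
                    | ∧-zeroʳ (subsetB X A) | ∧-zeroʳ (isStable G A) =
  ≡-sym (+-identityˡ _)
... | no t∉A rewrite disjointB-∪-out A Y t∉A | subsetB-∪-out X A t∉A
                   | ∧-zeroʳ (isStable G A) =
  ≡-sym (+-identityʳ _)

f-split : (G : Graph n) (X Y : Subset n) (t : Fin n) →
  f G X Y ≡ f G X (Y ∪ ⁅ t ⁆) + f G (X ∪ ⁅ t ⁆) Y
f-split {n} G X Y t =
  trans (sumL-cong _ _ (allSubsets n) (λ A → term-split G X Y A t))
        (sumL-+ (term G X (Y ∪ ⁅ t ⁆)) (term G (X ∪ ⁅ t ⁆) Y) (allSubsets n))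

counter-split : (G : Graph n) (s : Bool) (X Y : Subset n) (t : Fin n) →
  counter G s X Y ≡ counter G s X (Y ∪ ⁅ t ⁆) + counter G s (X ∪ ⁅ t ⁆) Y
counter-split G true  X Y t = f-split G X Y t
counter-split G false X Y t =
  trans (cong -_ (f-split G X Y t)) (neg-distrib-+ (f G X (Y ∪ ⁅ t ⁆)) (f G (X ∪ ⁅ t ⁆) Y))

Decides : Subset n → Subset n → Set
Decides {n} X Y = ∀ (v : Fin n) → v ∈ X ⊎ v ∈ Y

st : Graph n → Subset n → ℤ
st G X = if isStable G X then signPow (card X) else 0ℤ

sumL-extensions : (h : Subset (Nat.suc n) → ℤ) (L : List (Subset n)) →
  sumL h (concatMap (λ s → (false ∷ s) ∷ (true ∷ s) ∷ []) L)
    ≡ sumL (λ s → h (false ∷ s) + h (true ∷ s)) L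
sumL-extensions h [] = refl
sumL-extensions h (s ∷ L) =
  trans (cong (λ rest → h (false ∷ s) + (h (true ∷ s) + rest)) (sumL-extensions h L))
        (≡-sym (+-assoc (h (false ∷ s)) (h (true ∷ s)) _))

sum-single : ∀ n (h : Subset n → ℤ) (S : Subset n) →
  (∀ A → A ≢ S → h A ≡ 0ℤ) → sumL h (allSubsets n) ≡ h S
sum-single Nat.zero h [] others = +-identityʳ (h [])
sum-single (Nat.suc n) h (b ∷ S) others =
  trans (sumL-extensions h (allSubsets n))
        (trans (sum-single n pairSum S pairOthers) (pairAt b others))
  where
  pairSum : Subset n → ℤ
  pairSum s = h (false ∷ s) + h (true ∷ s)
  pairOthers : ∀ A → A ≢ S → pairSum A ≡ 0ℤ
  pairOthers A A≢S = cong₂ _+_ (others _ (A≢S ∘ ∷-injectiveʳ)) (others _ (A≢S ∘ ∷-injectiveʳ))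
  pairAt : ∀ c → (∀ A → A ≢ c ∷ S → h A ≡ 0ℤ) → pairSum S ≡ h (c ∷ S)
  pairAt false zeroElsewhere =
    trans (cong (_+_ (h (false ∷ S))) (zeroElsewhere (true ∷ S) λ ())) (+-identityʳ _)
  pairAt true zeroElsewhere =
    trans (cong (_+ h (true ∷ S)) (zeroElsewhere (false ∷ S) λ ())) (+-identityˡ _)

-- When (X, Y) decides every vertex, X is the only candidate summand.
f-decided : (G : Graph n) → Disjoint X Y → Decides X Y → f G X Y ≡ st G X
f-decided {n} {X} {Y} G disjoint decides = trans (sum-single n (term G X Y) X others) atX
  where
  forced : ∀ {A} → X ⊆ A → Disjoint A Y → A ≡ X
  forced {A} X⊆A A∩Y=∅ = ⊆-antisym (λ v∈A → [ (λ v∈X → v∈X) , (λ v∈Y → ⊥-elim (A∩Y=∅ v∈A v∈Y)) ]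
                                               (decides _)) X⊆A
  others : ∀ A → A ≢ X → term G X Y A ≡ 0ℤ
  others A A≢X with subsetB X A in e₁ | disjointB A Y in e₂
  ... | false | _     rewrite ∧-zeroʳ (isStable G A) = refl
  ... | true  | false rewrite ∧-zeroʳ (isStable G A) = refl
  ... | true  | true  = ⊥-elim (A≢X (forced (subsetB-sound X A e₁) (disjointB-sound A Y e₂)))
  atX : term G X Y X ≡ st G X
  atX rewrite subsetB-complete X X ⊆-refl | disjointB-complete X Y disjoint
            | ∧-identityʳ (isStable G X) = refl

-- Stability across a set closed under adjacency

Closed : Graph n → Subset n → Set
Closed G C = ∀ {a b} → a ∈ C → b ∉ C → adj G a b ≡ false

closed-∁ : (G : Graph n) → Closed G C → Closed G (∁ C)
closed-∁ G closed a∈∁C b∉∁C =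
  trans (Graph.sym G _ _) (closed (x∉∁p⇒x∈p b∉∁C) (x∈∁p⇒x∉p a∈∁C))

card-∪ : Disjoint P Q → card (P ∪ Q) ≡ card P Nat.+ card Q
card-∪ {P = []} {[]} _ = refl
card-∪ {P = true ∷ P} {true ∷ Q} disjoint = ⊥-elim (disjoint Vec.here Vec.here)
card-∪ {P = true ∷ P} {false ∷ Q} disjoint =
  cong Nat.suc (card-∪ (λ m → disjoint (Vec.there m) ∘ Vec.there))
card-∪ {P = false ∷ P} {true ∷ Q} disjoint =
  trans (cong Nat.suc (card-∪ (λ m → disjoint (Vec.there m) ∘ Vec.there)))
        (≡-sym (Nat.+-suc (card P) (card Q)))
card-∪ {P = false ∷ P} {false ∷ Q} disjoint = card-∪ (λ m → disjoint (Vec.there m) ∘ Vec.there)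

signPow-+ : ∀ a b → signPow (a Nat.+ b) ≡ signPow a * signPow b
signPow-+ Nat.zero b = ≡-sym (*-identityˡ (signPow b))
signPow-+ (Nat.suc a) b = trans (cong -_ (signPow-+ a b)) (neg-distribˡ-* (signPow a) (signPow b))

isStable-∪ : (G : Graph n) → Closed G C → P ⊆ C → Q ⊆ ∁ C →
  isStable G (P ∪ Q) ≡ isStable G P ∧ isStable G Q
isStable-∪ {C = C} {P} {Q} G closed P⊆C Q⊆∁C = ⇔→≡ (mk⇔ halves joined)
  where
  halves : isStable G (P ∪ Q) ≡ true → isStable G P ∧ isStable G Q ≡ true
  halves e = true-∧
    (isStable-complete G P (λ u∈P v∈P → isStable-sound G (P ∪ Q) e (p⊆p∪q Q u∈P) (p⊆p∪q Q v∈P)))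
    (isStable-complete G Q (λ u∈Q v∈Q → isStable-sound G (P ∪ Q) e (q⊆p∪q P Q u∈Q) (q⊆p∪q P Q v∈Q)))
  crossing : ∀ {a b} → a ∈ P → b ∈ Q → adj G a b ≡ false
  crossing a∈P b∈Q = closed (P⊆C a∈P) (x∈∁p⇒x∉p (Q⊆∁C b∈Q))
  joined : isStable G P ∧ isStable G Q ≡ true → isStable G (P ∪ Q) ≡ true
  joined e with ∧-true e
  ... | stableP , stableQ = isStable-complete G (P ∪ Q) λ {u} {v} u∈ v∈ → pairs (x∈p∪q⁻ P Q u∈) (x∈p∪q⁻ P Q v∈)
    where
    pairs : u ∈ P ⊎ u ∈ Q → v ∈ P ⊎ v ∈ Q → adj G u v ≡ false
    pairs (inj₁ u∈P) (inj₁ v∈P) = isStable-sound G P stableP u∈P v∈P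
    pairs (inj₁ u∈P) (inj₂ v∈Q) = crossing u∈P v∈Q
    pairs (inj₂ u∈Q) (inj₁ v∈P) = trans (Graph.sym G _ _) (crossing v∈P u∈Q)
    pairs (inj₂ u∈Q) (inj₂ v∈Q) = isStable-sound G Q stableQ u∈Q v∈Q

st-∪ : (G : Graph n) → Closed G C → P ⊆ C → Q ⊆ ∁ C → st G (P ∪ Q) ≡ st G P * st G Q
st-∪ {P = P} {Q} G closed P⊆C Q⊆∁C
  rewrite isStable-∪ G closed P⊆C Q⊆∁C | card-∪ (λ v∈P → x∈p⇒x∉∁p (P⊆C v∈P) ∘ Q⊆∁C)
  with isStable G P | isStable G Q
... | true  | true  = signPow-+ (card P) (card Q)
... | true  | false = ≡-sym (*-zeroʳ (signPow (card P)))
... | false | _     = refl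

st-split : (G : Graph n) → Closed G C → (X : Subset n) → st G X ≡ st G (X ∩ C) * st G (X ∩ ∁ C)
st-split {C = C} G closed X =
  trans (cong (st G) (≡-sym halves)) (st-∪ G closed (p∩q⊆q X C) (p∩q⊆q X (∁ C)))
  where
  open ≡-Reasoning
  halves : (X ∩ C) ∪ (X ∩ ∁ C) ≡ X
  halves = begin
    (X ∩ C) ∪ (X ∩ ∁ C) ≡⟨ ≡-sym (∩-distribˡ-∪ X C (∁ C)) ⟩
    X ∩ (C ∪ ∁ C)       ≡⟨ cong (X ∩_) (p∪∁p≡⊤ C) ⟩
    X ∩ ⊤               ≡⟨ ∩-identityʳ X ⟩
    X                   ∎

-- The product formula

part : Graph n → Subset n → Subset n → Subset n → ℤ
part G D X Y = f G (X ∩ D) ((Y ∩ D) ∪ ∁ D)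

Factorises : Graph n → Subset n → Subset n → Subset n → Set
Factorises G C X Y = f G X Y ≡ part G C X Y * part G (∁ C) X Y

∁-involutive : (C : Subset n) → ∁ (∁ C) ≡ C
∁-involutive {n} = BooleanAlgebraProperties.¬-involutive (∪-∩-booleanAlgebra n)

⁅⁆∩-in : t ∈ D → ⁅ t ⁆ ∩ D ≡ ⁅ t ⁆
⁅⁆∩-in {t = t} {D} t∈D =
  ⊆-antisym (proj₁ ∘ x∈p∩q⁻ ⁅ t ⁆ D)
            (λ v∈⁅t⁆ → x∈p∩q⁺ (v∈⁅t⁆ , subst (_∈ D) (≡-sym (x∈⁅y⁆⇒x≡y t v∈⁅t⁆)) t∈D))

⁅⁆∩-out : t ∉ D → ⁅ t ⁆ ∩ D ≡ ⊥
⁅⁆∩-out {t = t} {D} t∉D = Empty-unique λ { (v , v∈) → meets (x∈p∩q⁻ ⁅ t ⁆ D v∈) }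
  where
  meets : ∀ {v} → ¬ (v ∈ ⁅ t ⁆ × v ∈ D)
  meets (v∈⁅t⁆ , v∈D) = t∉D (subst (_∈ D) (x∈⁅y⁆⇒x≡y t v∈⁅t⁆) v∈D)

∪⁅⁆∩-in : (Z : Subset n) → t ∈ D → (Z ∪ ⁅ t ⁆) ∩ D ≡ (Z ∩ D) ∪ ⁅ t ⁆
∪⁅⁆∩-in {t = t} {D} Z t∈D = trans (∩-distribʳ-∪ D Z ⁅ t ⁆) (cong ((Z ∩ D) ∪_) (⁅⁆∩-in t∈D))

∪⁅⁆∩-out : (Z : Subset n) → t ∉ D → (Z ∪ ⁅ t ⁆) ∩ D ≡ Z ∩ D
∪⁅⁆∩-out {t = t} {D} Z t∉D =
  trans (∩-distribʳ-∪ D Z ⁅ t ⁆) (trans (cong ((Z ∩ D) ∪_) (⁅⁆∩-out t∉D)) (∪-identityʳ (Z ∩ D)))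

∪-swap : (a b c : Subset n) → (a ∪ b) ∪ c ≡ (a ∪ c) ∪ b
∪-swap a b c = trans (∪-assoc a b c) (trans (cong (a ∪_) (∪-comm b c)) (≡-sym (∪-assoc a c b)))

-- Deciding a vertex t ∈ D on both sides of the deletion–contraction identity:
-- only the part on D changes, and it recombines by the same identity.
factorises-step : (G : Graph n) (X Y : Subset n) → t ∈ D →
  Factorises G D X (Y ∪ ⁅ t ⁆) → Factorises G D (X ∪ ⁅ t ⁆) Y → Factorises G D X Y
factorises-step {t = t} {D} G X Y t∈D forbid require = begin
  f G X Y
    ≡⟨ f-split G X Y t ⟩
  f G X (Y ∪ ⁅ t ⁆) + f G (X ∪ ⁅ t ⁆) Y
    ≡⟨ cong₂ _+_ forbid require ⟩
  part G D X (Y ∪ ⁅ t ⁆) * part G (∁ D) X (Y ∪ ⁅ t ⁆)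
    + part G D (X ∪ ⁅ t ⁆) Y * part G (∁ D) (X ∪ ⁅ t ⁆) Y
    ≡⟨ cong₂ _+_ (cong₂ _*_ forbidInside forbidOutside) (cong₂ _*_ requireInside requireOutside) ⟩
  f G (X ∩ D) (R ∪ ⁅ t ⁆) * F + f G ((X ∩ D) ∪ ⁅ t ⁆) R * F
    ≡⟨ ≡-sym (*-distribʳ-+ F (f G (X ∩ D) (R ∪ ⁅ t ⁆)) (f G ((X ∩ D) ∪ ⁅ t ⁆) R)) ⟩
  (f G (X ∩ D) (R ∪ ⁅ t ⁆) + f G ((X ∩ D) ∪ ⁅ t ⁆) R) * F
    ≡⟨ cong (_* F) (≡-sym (f-split G (X ∩ D) R t)) ⟩
  part G D X Y * F ∎
  where
  open ≡-Reasoning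
  R : Subset _
  R = (Y ∩ D) ∪ ∁ D
  F : ℤ
  F = part G (∁ D) X Y
  t∉∁D : t ∉ ∁ D
  t∉∁D = x∈p⇒x∉∁p t∈D
  forbidInside : part G D X (Y ∪ ⁅ t ⁆) ≡ f G (X ∩ D) (R ∪ ⁅ t ⁆)
  forbidInside = cong (f G (X ∩ D))
    (trans (cong (_∪ ∁ D) (∪⁅⁆∩-in Y t∈D)) (∪-swap (Y ∩ D) ⁅ t ⁆ (∁ D)))
  forbidOutside : part G (∁ D) X (Y ∪ ⁅ t ⁆) ≡ F
  forbidOutside = cong (λ Z → f G (X ∩ ∁ D) (Z ∪ ∁ (∁ D))) (∪⁅⁆∩-out Y t∉∁D)
  requireInside : part G D (X ∪ ⁅ t ⁆) Y ≡ f G ((X ∩ D) ∪ ⁅ t ⁆) R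
  requireInside = cong (λ Z → f G Z R) (∪⁅⁆∩-in X t∈D)
  requireOutside : part G (∁ D) (X ∪ ⁅ t ⁆) Y ≡ F
  requireOutside = cong (λ Z → f G Z ((Y ∩ ∁ D) ∪ ∁ (∁ D))) (∪⁅⁆∩-out X t∉∁D)

factorises-∁ : (G : Graph n) (C X Y : Subset n) → Factorises G (∁ C) X Y → Factorises G C X Y
factorises-∁ G C X Y fact =
  trans fact (trans (cong (part G (∁ C) X Y *_) (cong (λ D → part G D X Y) (∁-involutive C)))
                    (*-comm (part G (∁ C) X Y) (part G C X Y)))

-- At a fully decided pair both sides evaluate to st, which is multiplicative.
part-decided : (G : Graph n) (D : Subset n) → Disjoint X Y → Decides X Y →
  part G D X Y ≡ st G (X ∩ D)
part-decided {X = X} {Y} G D disjoint decides = f-decided G disjointD decidesD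
  where
  disjointD : Disjoint (X ∩ D) ((Y ∩ D) ∪ ∁ D)
  disjointD v∈X∩D v∈R with x∈p∩q⁻ X D v∈X∩D | x∈p∪q⁻ (Y ∩ D) (∁ D) v∈R
  ... | v∈X , _   | inj₁ v∈Y∩D = disjoint v∈X (proj₁ (x∈p∩q⁻ Y D v∈Y∩D))
  ... | _   , v∈D | inj₂ v∈∁D  = x∈∁p⇒x∉p v∈∁D v∈D
  decidesD : Decides (X ∩ D) ((Y ∩ D) ∪ ∁ D)
  decidesD v with v ∈? D | decides v
  ... | no  v∉D | _        = inj₂ (q⊆p∪q (Y ∩ D) (∁ D) (x∉p⇒x∈∁p v∉D))
  ... | yes v∈D | inj₁ v∈X = inj₁ (x∈p∩q⁺ (v∈X , v∈D))
  ... | yes v∈D | inj₂ v∈Y = inj₂ (p⊆p∪q (∁ D) (x∈p∩q⁺ (v∈Y , v∈D)))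

factorises-decided : (G : Graph n) → Closed G C → Disjoint X Y → Decides X Y → Factorises G C X Y
factorises-decided {C = C} {X} G closed disjoint decides =
  trans (f-decided G disjoint decides)
    (trans (st-split G closed X)
           (≡-sym (cong₂ _*_ (part-decided G C disjoint decides)
                             (part-decided G (∁ C) disjoint decides))))

Pending : List (Fin n) → Subset n → Subset n → Set
Pending {n} L X Y = ∀ (v : Fin n) → v ∈ₗ L ⊎ v ∈ X ⊎ v ∈ Y

pending-step : ∀ {X′ Y′ : Subset n} {L} → Pending (t ∷ L) X Y →
  t ∈ X′ ⊎ t ∈ Y′ → X ⊆ X′ → Y ⊆ Y′ → Pending L X′ Y′
pending-step pending decided X⊆X′ Y⊆Y′ v with pending v
... | inj₁ (Any.here refl)  = inj₂ decided
... | inj₁ (Any.there v∈L) = inj₁ v∈L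
... | inj₂ (inj₁ v∈X)       = inj₂ (inj₁ (X⊆X′ v∈X))
... | inj₂ (inj₂ v∈Y)       = inj₂ (inj₂ (Y⊆Y′ v∈Y))

-- Decide the pending vertices one by one, for every closed C at once.
factorises : (G : Graph n) (L : List (Fin n)) (X Y : Subset n) →
  Closed G C → Disjoint X Y → Pending L X Y → Factorises G C X Y
factorises G [] X Y closed disjoint pending =
  factorises-decided G closed disjoint λ v → [ (λ ()) , (λ decided → decided) ] (pending v)
factorises {C = C} G (t ∷ L) X Y closed disjoint pending with t ∈? X | t ∈? Y
... | yes t∈X | _ =
  factorises G L X Y closed disjoint (pending-step pending (inj₁ t∈X) ⊆-refl ⊆-refl)
... | no _ | yes t∈Y =
  factorises G L X Y closed disjoint (pending-step pending (inj₂ t∈Y) ⊆-refl ⊆-refl)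
... | no t∉X | no t∉Y = splitAt (t ∈? C)
  where
  forbid : ∀ {D} → Closed G D → Factorises G D X (Y ∪ ⁅ t ⁆)
  forbid closedD = factorises G L X (Y ∪ ⁅ t ⁆) closedD
    (λ v∈X → [ disjoint v∈X , (λ { refl → t∉X v∈X }) ] ∘ ∈-∪⁅⁆)
    (pending-step pending (inj₂ ∈-∪⁅⁆-new) ⊆-refl ∈-∪⁅⁆-old)
  require : ∀ {D} → Closed G D → Factorises G D (X ∪ ⁅ t ⁆) Y
  require closedD = factorises G L (X ∪ ⁅ t ⁆) Y closedD
    ([ disjoint , (λ { refl → t∉Y }) ] ∘ ∈-∪⁅⁆)
    (pending-step pending (inj₁ ∈-∪⁅⁆-new) ∈-∪⁅⁆-old ⊆-refl)
  splitAt : Dec (t ∈ C) → Factorises G C X Y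
  splitAt (yes t∈C) = factorises-step G X Y t∈C (forbid closed) (require closed)
  splitAt (no t∉C)  = factorises-∁ G C X Y
    (factorises-step G X Y (x∉p⇒x∈∁p t∉C) (forbid (closed-∁ G closed)) (require (closed-∁ G closed)))

product-formula : (G : Graph n) → Closed G C → f G ⊥ ⊥ ≡ f G ⊥ (∁ C) * f G ⊥ C
product-formula {n} {C} G closed =
  trans (factorises G (allFin n) ⊥ ⊥ closed (λ _ → ∉⊥) (λ v → inj₁ (∈-allFin v)))
        (cong₂ _*_ (emptyPart C) (trans (emptyPart (∁ C)) (cong (f G ⊥) (∁-involutive C))))
  where
  emptyPart : ∀ D → part G D ⊥ ⊥ ≡ f G ⊥ (∁ D)
  emptyPart D rewrite ∩-zeroˡ D | ∪-identityˡ (∁ D) = refl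

record Component (G : Graph n) (u : Fin n) : Set where
  field
    members   : Subset n
    root      : u ∈ members
    reachable : ∀ {v} → v ∈ members → Reachable G u v
    closed    : Closed G members

reachable-snoc : {G : Graph n} → Reachable G u v → v ~[ G ] t → Reachable G u t
reachable-snoc here          edge = step edge here
reachable-snoc (step e walk) edge = step e (reachable-snoc walk edge)

-- Add endpoints of edges leaving the current set until none is left; the
-- fuel outlasts the at most n additions.
grow : (G : Graph n) (u : Fin n) (fuel : ℕ) (R : Subset n) → u ∈ R →
  (∀ {v} → v ∈ R → Reachable G u v) → n Nat.< card R Nat.+ fuel → Component G u
grow {n} G u Nat.zero R _ _ tooFew =
  ⊥-elim (Nat.≤⇒≯ (∣p∣≤n R) (subst (n Nat.<_) (Nat.+-identityʳ (card R)) tooFew))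
grow {n} G u (Nat.suc fuel) R u∈R reach tooFew
  with any? (λ a → any? (λ b → a ∈? R ×-dec (¬? (b ∈? R) ×-dec (adj G a b Bool.≟ true))))
... | no noExit = record
  { members = R ; root = u∈R ; reachable = reach
  ; closed = λ {a} {b} a∈R b∉R → ¬-not (λ edge → noExit (a , b , a∈R , b∉R , edge)) }
... | yes (a , b , a∈R , b∉R , edge) =
  grow G u fuel (R ∪ ⁅ b ⁆) (∈-∪⁅⁆-old u∈R) reach′ (subst (n Nat.<_) (≡-sym grown) tooFew)
  where
  reach′ : ∀ {v} → v ∈ R ∪ ⁅ b ⁆ → Reachable G u v
  reach′ v∈ = [ reach , (λ { refl → reachable-snoc (reach a∈R) edge }) ] (∈-∪⁅⁆ v∈)
  fresh : Disjoint R ⁅ b ⁆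
  fresh v∈R v∈⁅b⁆ = b∉R (subst (_∈ R) (x∈⁅y⁆⇒x≡y b v∈⁅b⁆) v∈R)
  grown : card (R ∪ ⁅ b ⁆) Nat.+ fuel ≡ card R Nat.+ Nat.suc fuel
  grown = trans (cong (Nat._+ fuel) (trans (card-∪ fresh) (cong (card R Nat.+_) (∣⁅x⁆∣≡1 b))))
                (Nat.+-assoc (card R) 1 fuel)

component : (G : Graph n) (u : Fin n) → Component G u
component {n} G u = grow G u n ⁅ u ⁆ (x∈⁅x⁆ u)
  (λ v∈ → subst (Reachable G u) (≡-sym (x∈⁅y⁆⇒x≡y u v∈)) here)
  (subst (λ k → n Nat.< k Nat.+ n) (≡-sym (∣⁅x⁆∣≡1 u)) (Nat.n<1+n n))

∣counter∣ : (G : Graph n) (s : Bool) (X Y : Subset n) → ∣ counter G s X Y ∣ ≡ ∣ f G X Y ∣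
∣counter∣ G true  X Y = refl
∣counter∣ G false X Y = ∣-i∣≡∣i∣ (f G X Y)

empty-⊥ : Empty (⊥ {n})
empty-⊥ (_ , v∈⊥) = ∉⊥ v∈⊥

bound-forbidden : (G : Graph n) (s : Bool) → IsGood G s → Nonempty Y → ∣ counter G s ⊥ Y ∣ Nat.≤ 1
bound-forbidden {Y = Y} G s good nonempty = proj₁ (good ⊥ Y
  (subst Empty (≡-sym (∩-zeroˡ Y)) empty-⊥) (subst Nonempty (≡-sym (∪-identityˡ Y)) nonempty))

bound-required : (G : Graph n) (s : Bool) → IsGood G s → Nonempty X → ∣ counter G s X ⊥ ∣ Nat.≤ 1
bound-required {X = X} G s good nonempty = proj₁ (good X ⊥
  (subst Empty (≡-sym (∩-zeroʳ X)) empty-⊥) (subst Nonempty (≡-sym (∪-identityʳ X)) nonempty))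

at-most-one : ∀ a → ∣ a ∣ Nat.≤ 1 → a ≤ + 1
at-most-one (+ _)    a≤1 = +≤+ a≤1
at-most-one -[1+ _ ] _   = -≤+

is-one : ∀ a → ∣ a ∣ Nat.≤ 1 → + 2 ≤ a + + 1 → a ≡ + 1
is-one (+ 1)                   _            _                  = refl
is-one (+ 0)                   _            (+≤+ (Nat.s≤s ()))
is-one (+ Nat.suc (Nat.suc _)) (Nat.s≤s ()) _
is-one -[1+ 0 ]                _            (+≤+ ())
is-one -[1+ Nat.suc _ ]        (Nat.s≤s ()) _

unit-sum : ∀ a b → ∣ a ∣ Nat.≤ 1 → ∣ b ∣ Nat.≤ 1 → + 2 ≤ a + b → a ≡ + 1 × b ≡ + 1
unit-sum a b ha hb two≤ =
  is-one a ha (≤-trans two≤ (+-monoʳ-≤ a (at-most-one b hb))) ,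
  is-one b hb (≤-trans two≤ (subst (a + b ≤_) (+-comm (+ 1) b) (+-monoˡ-≤ b (at-most-one a ha))))

counter-split-∅ : (G : Graph n) (s : Bool) (v : Fin n) →
  counter G s ⊥ ⊥ ≡ counter G s ⊥ ⁅ v ⁆ + counter G s ⁅ v ⁆ ⊥
counter-split-∅ G s v = subst (λ V → counter G s ⊥ ⊥ ≡ counter G s ⊥ V + counter G s V ⊥)
                              (∪-identityˡ ⁅ v ⁆) (counter-split G s ⊥ ⊥ v)

split-at-vertex : (G : Graph n) (s : Bool) → IsGood G s → + 2 ≤ counter G s ⊥ ⊥ →
  ∀ v → counter G s ⊥ ⊥ ≡ + 2 × counter G s ⁅ v ⁆ ⊥ ≡ + 1
split-at-vertex G s good two≤ v
  with unit-sum (counter G s ⊥ ⁅ v ⁆) (counter G s ⁅ v ⁆ ⊥)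
         (bound-forbidden G s good (v , x∈⁅x⁆ v)) (bound-required G s good (v , x∈⁅x⁆ v))
         (subst (+ 2 ≤_) (counter-split-∅ G s v) two≤)
... | forbidden≡1 , required≡1 =
  trans (counter-split-∅ G s v) (cong₂ _+_ forbidden≡1 required≡1) , required≡1

-- A closed set containing u but missing v would bound |g(∅)| by 1.
connected : (G : Graph n) (s : Bool) → IsGood G s → + 2 ≤ counter G s ⊥ ⊥ → Connected G
connected G s good two≤ u v with component G u
... | record { members = C ; root = u∈C ; reachable = reach ; closed = closed } with v ∈? C
...   | yes v∈C = reach v∈C
...   | no v∉C = ⊥-elim (Nat.≤⇒≯ atMostOne (atLeastTwo two≤))
  where
  factorBound : ∀ {Y} → Nonempty Y → ∣ f G ⊥ Y ∣ Nat.≤ 1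
  factorBound {Y} nonempty =
    subst (Nat._≤ 1) (∣counter∣ G s ⊥ Y) (bound-forbidden G s good nonempty)
  atMostOne : ∣ counter G s ⊥ ⊥ ∣ Nat.≤ 1
  atMostOne rewrite ∣counter∣ G s ⊥ ⊥ | product-formula G closed | abs-* (f G ⊥ (∁ C)) (f G ⊥ C) =
    Nat.*-mono-≤ (factorBound (v , x∉p⇒x∈∁p v∉C)) (factorBound (u , u∈C))
  atLeastTwo : ∀ {x} → + 2 ≤ x → 2 Nat.≤ ∣ x ∣
  atLeastTwo (+≤+ 2≤x) = 2≤x

-- On the empty vertex set g(∅) = ±1, so the hypothesis g(∅) ≥ 2 fails; otherwise
-- split g(∅) at some vertex and use the component argument.
mainTheorem11 : ∀ {n} (G : Graph n) (s : Bool) →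
    NoInducedCycleLen0mod3 G → IsGood G s → + 2 ≤ counter G s ⊥ ⊥ →
    (counter G s ⊥ ⊥ ≡ + 2) × (∀ (v : Fin n) → counter G s ⁅ v ⁆ ⊥ ≡ + 1) × Connected G
mainTheorem11 {Nat.zero} G true  _ _ (+≤+ (Nat.s≤s ()))
mainTheorem11 {Nat.zero} G false _ _ ()
mainTheorem11 {Nat.suc _} G s _ good two≤ =
  proj₁ (split-at-vertex G s good two≤ zero) ,
  (λ v → proj₂ (split-at-vertex G s good two≤ v)) ,
  connected G s good two≤
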